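{- For any positive integers $k_1,k_2,k_3$, the coefficient of $x_1^{k_1}x_2^{k_2}x_3^{k_3}$ in the polynomial $(x_1-x_2)(x_2-x_3)(x_1+x_2+x_3)^{k_1+k_2+k_3-2}$ equals $$\frac{(k_1+k_2+k_3-2)!}{k_1!\,k_2!\,k_3!}\bigl(k_2+(k_2-k_1)(k_3-k_2)\bigr).$$ -}

module Defs where

open import Data.Nat as ℕ using (ℕ; zero; suc; _∸_; NonZero)
open import Data.Nat.Properties using (m*n≢0; _!≢0)
open import Data.Integer as ℤ using (ℤ; +_; 0ℤ; 1ℤ)
open import Data.Rational as ℚ using (ℚ)
open import Data.Bool using (if_then_else_)
open import Data.Product using (_×_; _,_)

-- Polynomials in ℤ[x₁,x₂,x₃], represented by their coefficient function:
-- P a b c is the coefficient of x₁^a x₂^b x₃^c.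
Poly3 : Set
Poly3 = ℕ → ℕ → ℕ → ℤ

sumTo : ℕ → (ℕ → ℤ) → ℤ
sumTo zero    f = f zero
sumTo (suc n) f = sumTo n f ℤ.+ f (suc n)

coeff : Poly3 → ℕ → ℕ → ℕ → ℤ
coeff P a b c = P a b c

mono : ℕ → ℕ → ℕ → Poly3
mono a b c i j k =
  if (a ℕ.≡ᵇ i) Data.Bool.∧ (b ℕ.≡ᵇ j) Data.Bool.∧ (c ℕ.≡ᵇ k) then 1ℤ else 0ℤ

one x₁ x₂ x₃ : Poly3
one = mono 0 0 0
x₁  = mono 1 0 0
x₂  = mono 0 1 0
x₃  = mono 0 0 1

infixl 6 _⊕_ _⊖_
infixl 7 _⊛_
infixr 8 _^ₚ_

_⊕_ : Poly3 → Poly3 → Poly3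
(P ⊕ Q) a b c = P a b c ℤ.+ Q a b c

_⊖_ : Poly3 → Poly3 → Poly3
(P ⊖ Q) a b c = P a b c ℤ.- Q a b c

_⊛_ : Poly3 → Poly3 → Poly3
(P ⊛ Q) a b c =
  sumTo a λ i → sumTo b λ j → sumTo c λ k →
    P i j k ℤ.* Q (a ∸ i) (b ∸ j) (c ∸ k)

_^ₚ_ : Poly3 → ℕ → Poly3
P ^ₚ zero  = one
P ^ₚ suc n = P ⊛ (P ^ₚ n)

fact3 : ℕ → ℕ → ℕ → ℕ
fact3 k₁ k₂ k₃ = k₁ ℕ.! ℕ.* k₂ ℕ.! ℕ.* k₃ ℕ.!

_/fact3_ : ℤ → (ℕ × ℕ × ℕ) → ℚ
z /fact3 (k₁ , k₂ , k₃) = z ℚ./ fact3 k₁ k₂ k₃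
  where instance
    _ : NonZero (fact3 k₁ k₂ k₃)
    _ = m*n≢0 (k₁ ℕ.! ℕ.* k₂ ℕ.!) (k₃ ℕ.!)
          {{m*n≢0 (k₁ ℕ.!) (k₂ ℕ.!) {{k₁ !≢0}} {{k₂ !≢0}}}} {{k₃ !≢0}}

toℚ : ℤ → ℚ
toℚ z = z ℚ./ 1

-- (x₁ − x₂)(x₂ − x₃) = x₁x₂ − x₁x₃ − x₂² + x₂x₃. Multiplying by a monomial x^e shifts
-- coefficients, so by the multinomial theorem the coefficient of x^k in x^e (x₁ + x₂ + x₃)^n,
-- for |k| = |e| + n, is n!/(k − e)! = k₁^(e₁) k₂^(e₂) k₃^(e₃) · n!/k! in falling factorials.
-- Summing the four terms gives n!/k! · (k₁k₂ − k₁k₃ − k₂(k₂ − 1) + k₂k₃), and the bracket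
-- equals k₂ + (k₂ − k₁)(k₃ − k₂).
module Submission where

open import Defs
open import Data.Nat as ℕ using (ℕ; zero; suc; _∸_; _≤_; z≤n; s≤s; _!; NonZero)
import Data.Nat.Properties as ℕP
import Data.Nat.Tactic.RingSolver as ℕSolver
open import Data.Integer as ℤ using (ℤ; +_; 0ℤ; 1ℤ)
import Data.Integer.Properties as ℤP
open import Data.Integer.Tactic.RingSolver using (solve-∀)
open import Data.Rational as ℚ using (ℚ)
import Data.Rational.Properties as ℚP
open import Data.Rational.Unnormalised as ℚᵘ using (mkℚᵘ; *≡*)
import Data.Rational.Unnormalised.Properties as ℚᵘP
open import Data.Bool using (true; false; if_then_else_)
open import Data.Product using (_,_)
open import Relation.Binary.PropositionalEquality using (_≡_; refl; sym; trans; cong; cong₂; module ≡-Reasoning)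
open import Function using (_∘_)

sumTo-cong : ∀ n {f g : ℕ → ℤ} → (∀ i → f i ≡ g i) → sumTo n f ≡ sumTo n g
sumTo-cong zero    f≗g = f≗g zero
sumTo-cong (suc n) f≗g = cong₂ ℤ._+_ (sumTo-cong n f≗g) (f≗g (suc n))

sumTo-+ : ∀ n (f g : ℕ → ℤ) → sumTo n (λ i → f i ℤ.+ g i) ≡ sumTo n f ℤ.+ sumTo n g
sumTo-+ zero    f g = refl
sumTo-+ (suc n) f g =
  trans (cong (ℤ._+ (f (suc n) ℤ.+ g (suc n))) (sumTo-+ n f g))
        (interchange (sumTo n f) (sumTo n g) (f (suc n)) (g (suc n)))
  where
  interchange : ∀ a b c d → (a ℤ.+ b) ℤ.+ (c ℤ.+ d) ≡ (a ℤ.+ c) ℤ.+ (b ℤ.+ d)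
  interchange = solve-∀

sumTo-*ˡ : ∀ n x (f : ℕ → ℤ) → sumTo n (λ i → x ℤ.* f i) ≡ x ℤ.* sumTo n f
sumTo-*ˡ zero    x f = refl
sumTo-*ˡ (suc n) x f =
  trans (cong (ℤ._+ (x ℤ.* f (suc n))) (sumTo-*ˡ n x f))
        (sym (ℤP.*-distribˡ-+ x (sumTo n f) (f (suc n))))

sumTo-neg : ∀ n (f : ℕ → ℤ) → sumTo n (λ i → ℤ.- f i) ≡ ℤ.- sumTo n f
sumTo-neg zero    f = refl
sumTo-neg (suc n) f =
  trans (cong (ℤ._+ (ℤ.- f (suc n))) (sumTo-neg n f))
        (sym (ℤP.neg-distrib-+ (sumTo n f) (f (suc n))))

sumTo-- : ∀ n (f g : ℕ → ℤ) → sumTo n (λ i → f i ℤ.- g i) ≡ sumTo n f ℤ.- sumTo n g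
sumTo-- n f g = trans (sumTo-+ n f (λ i → ℤ.- g i)) (cong (ℤ._+_ (sumTo n f)) (sumTo-neg n g))

Σ³ : ℕ → ℕ → ℕ → (ℕ → ℕ → ℕ → ℤ) → ℤ
Σ³ a b c f = sumTo a λ i → sumTo b λ j → sumTo c λ k → f i j k

Σ³-cong : ∀ a b c {f g : ℕ → ℕ → ℕ → ℤ} →
          (∀ i j k → f i j k ≡ g i j k) → Σ³ a b c f ≡ Σ³ a b c g
Σ³-cong a b c f≗g = sumTo-cong a λ i → sumTo-cong b λ j → sumTo-cong c λ k → f≗g i j k

Σ³-hom : (_∙_ : ℤ → ℤ → ℤ) →
         (∀ n f g → sumTo n (λ i → f i ∙ g i) ≡ sumTo n f ∙ sumTo n g) →
         ∀ a b c f g → Σ³ a b c (λ i j k → f i j k ∙ g i j k) ≡ Σ³ a b c f ∙ Σ³ a b c g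
Σ³-hom _∙_ sumTo-∙ a b c f g =
  trans (sumTo-cong a λ i → trans (sumTo-cong b λ j → sumTo-∙ c _ _) (sumTo-∙ b _ _))
        (sumTo-∙ a _ _)

infix 4 _≗₃_

_≗₃_ : Poly3 → Poly3 → Set
P ≗₃ Q = ∀ a b c → P a b c ≡ Q a b c

⊛-congˡ : ∀ {P P′} R → P ≗₃ P′ → P ⊛ R ≗₃ P′ ⊛ R
⊛-congˡ R P≗P′ a b c =
  Σ³-cong a b c λ i j k → cong (ℤ._* R (a ∸ i) (b ∸ j) (c ∸ k)) (P≗P′ i j k)

⊛-distribʳ-⊕ : ∀ P Q R → (P ⊕ Q) ⊛ R ≗₃ P ⊛ R ⊕ Q ⊛ R
⊛-distribʳ-⊕ P Q R a b c =
  trans (Σ³-cong a b c λ i j k → ℤP.*-distribʳ-+ (R (a ∸ i) (b ∸ j) (c ∸ k)) (P i j k) (Q i j k))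
        (Σ³-hom ℤ._+_ sumTo-+ a b c _ _)

⊛-distribʳ-⊖ : ∀ P Q R → (P ⊖ Q) ⊛ R ≗₃ P ⊛ R ⊖ Q ⊛ R
⊛-distribʳ-⊖ P Q R a b c =
  trans (Σ³-cong a b c λ i j k → distrib (P i j k) (Q i j k) (R (a ∸ i) (b ∸ j) (c ∸ k)))
        (Σ³-hom ℤ._-_ sumTo-- a b c _ _)
  where
  distrib : ∀ x y z → (x ℤ.- y) ℤ.* z ≡ x ℤ.* z ℤ.- y ℤ.* z
  distrib = solve-∀

⊛-distribˡ-⊖ : ∀ P Q R → P ⊛ (Q ⊖ R) ≗₃ P ⊛ Q ⊖ P ⊛ R
⊛-distribˡ-⊖ P Q R a b c =
  trans (Σ³-cong a b c λ i j k →
           distrib (P i j k) (Q (a ∸ i) (b ∸ j) (c ∸ k)) (R (a ∸ i) (b ∸ j) (c ∸ k)))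
        (Σ³-hom ℤ._-_ sumTo-- a b c _ _)
  where
  distrib : ∀ x y z → x ℤ.* (y ℤ.- z) ≡ x ℤ.* y ℤ.- x ℤ.* z
  distrib = solve-∀

δ : ℕ → ℕ → ℤ
δ p i = if p ℕ.≡ᵇ i then 1ℤ else 0ℤ

mono-δ : ∀ p q r i j k → mono p q r i j k ≡ δ p i ℤ.* (δ q j ℤ.* δ r k)
mono-δ p q r i j k with p ℕ.≡ᵇ i | q ℕ.≡ᵇ j | r ℕ.≡ᵇ k
... | true  | true  | true  = refl
... | true  | true  | false = refl
... | true  | false | _     = refl
... | false | _     | _     = refl

infixr 8 [_≤_]_

[_≤_]_ : ℕ → ℕ → ℤ → ℤ
[ zero  ≤ n     ] x = x
[ suc p ≤ zero  ] x = 0ℤ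
[ suc p ≤ suc n ] x = [ p ≤ n ] x

[≤]-*ˡ : ∀ p n x y → [ p ≤ n ] (x ℤ.* y) ≡ x ℤ.* [ p ≤ n ] y
[≤]-*ˡ zero    n       x y = refl
[≤]-*ˡ (suc p) zero    x y = sym (ℤP.*-zeroʳ x)
[≤]-*ˡ (suc p) (suc n) x y = [≤]-*ˡ p n x y

[≤]-*ʳ : ∀ p n x y → [ p ≤ n ] (x ℤ.* y) ≡ ([ p ≤ n ] x) ℤ.* y
[≤]-*ʳ zero    n       x y = refl
[≤]-*ʳ (suc p) zero    x y = refl
[≤]-*ʳ (suc p) (suc n) x y = [≤]-*ʳ p n x y

[≤]-δ : ∀ p p′ n → [ p ≤ n ] δ p′ (n ∸ p) ≡ δ (p ℕ.+ p′) n
[≤]-δ zero    p′ n       = refl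
[≤]-δ (suc p) p′ zero    = refl
[≤]-δ (suc p) p′ (suc n) = [≤]-δ p p′ n

[≤]-+δ : ∀ p n x y → (p ≡ suc n → x ≡ y) → [ p ≤ n ] x ℤ.+ δ p (suc n) ℤ.* y ≡ [ p ≤ suc n ] x
[≤]-+δ zero          n       x y _       = ℤP.+-identityʳ x
[≤]-+δ (suc zero)    zero    x y p≡1⇒x≡y =
  trans (ℤP.+-identityˡ (1ℤ ℤ.* y)) (trans (ℤP.*-identityˡ y) (sym (p≡1⇒x≡y refl)))
[≤]-+δ (suc (suc p)) zero    x y _       = refl
[≤]-+δ (suc p)       (suc n) x y p≡n⇒x≡y = [≤]-+δ p n x y (p≡n⇒x≡y ∘ cong suc)

sumTo-δ : ∀ p n (f : ℕ → ℤ) → sumTo n (λ i → δ p i ℤ.* f i) ≡ [ p ≤ n ] f p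
sumTo-δ zero    zero    f = ℤP.*-identityˡ (f 0)
sumTo-δ (suc p) zero    f = refl
sumTo-δ p       (suc n) f =
  trans (cong (ℤ._+ (δ p (suc n) ℤ.* f (suc n))) (sumTo-δ p n f))
        ([≤]-+δ p n (f p) (f (suc n)) (cong f))

mono-⊛ : ∀ p q r R a b c →
         (mono p q r ⊛ R) a b c ≡ [ p ≤ a ] [ q ≤ b ] [ r ≤ c ] R (a ∸ p) (b ∸ q) (c ∸ r)
mono-⊛ p q r R a b c = begin
  Σ³ a b c (λ i j k → mono p q r i j k ℤ.* R′ i j k)
    ≡⟨ Σ³-cong a b c (λ i j k → trans (cong (ℤ._* R′ i j k) (mono-δ p q r i j k))
                                      (reassoc (δ p i) (δ q j) (δ r k) (R′ i j k))) ⟩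
  Σ³ a b c (λ i j k → δ p i ℤ.* (δ q j ℤ.* (δ r k ℤ.* R′ i j k)))
    ≡⟨ sumTo-cong a (λ i → sumTo-cong b λ j →
         trans (sumTo-*ˡ c (δ p i) _) (cong (δ p i ℤ.*_)
           (trans (sumTo-*ˡ c (δ q j) _) (cong (δ q j ℤ.*_) (sumTo-δ r c (R′ i j)))))) ⟩
  sumTo a (λ i → sumTo b λ j → δ p i ℤ.* (δ q j ℤ.* [ r ≤ c ] R′ i j r))
    ≡⟨ sumTo-cong a (λ i → trans (sumTo-*ˡ b (δ p i) _)
                                 (cong (δ p i ℤ.*_) (sumTo-δ q b (λ j → [ r ≤ c ] R′ i j r)))) ⟩
  sumTo a (λ i → δ p i ℤ.* [ q ≤ b ] [ r ≤ c ] R′ i q r)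
    ≡⟨ sumTo-δ p a (λ i → [ q ≤ b ] [ r ≤ c ] R′ i q r) ⟩
  [ p ≤ a ] [ q ≤ b ] [ r ≤ c ] R′ p q r ∎
  where
  open ≡-Reasoning
  R′ : ℕ → ℕ → ℕ → ℤ
  R′ i j k = R (a ∸ i) (b ∸ j) (c ∸ k)
  reassoc : ∀ x y z w → x ℤ.* (y ℤ.* z) ℤ.* w ≡ x ℤ.* (y ℤ.* (z ℤ.* w))
  reassoc = solve-∀

mono-⊛-mono : ∀ p q r p′ q′ r′ →
              mono p q r ⊛ mono p′ q′ r′ ≗₃ mono (p ℕ.+ p′) (q ℕ.+ q′) (r ℕ.+ r′)
mono-⊛-mono p q r p′ q′ r′ a b c = begin
  (mono p q r ⊛ mono p′ q′ r′) a b c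
    ≡⟨ mono-⊛ p q r (mono p′ q′ r′) a b c ⟩
  [ p ≤ a ] [ q ≤ b ] [ r ≤ c ] mono p′ q′ r′ (a ∸ p) (b ∸ q) (c ∸ r)
    ≡⟨ cong ([ p ≤ a ]_ ∘ [ q ≤ b ]_ ∘ [ r ≤ c ]_) (mono-δ p′ q′ r′ (a ∸ p) (b ∸ q) (c ∸ r)) ⟩
  [ p ≤ a ] [ q ≤ b ] [ r ≤ c ] (X ℤ.* (Y ℤ.* Z))
    ≡⟨ cong ([ p ≤ a ]_ ∘ [ q ≤ b ]_)
            (trans ([≤]-*ˡ r c X (Y ℤ.* Z)) (cong (X ℤ.*_) ([≤]-*ˡ r c Y Z))) ⟩
  [ p ≤ a ] [ q ≤ b ] (X ℤ.* (Y ℤ.* [ r ≤ c ] Z))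
    ≡⟨ cong [ p ≤ a ]_ (trans ([≤]-*ˡ q b X _) (cong (X ℤ.*_) ([≤]-*ʳ q b Y _))) ⟩
  [ p ≤ a ] (X ℤ.* (([ q ≤ b ] Y) ℤ.* [ r ≤ c ] Z))
    ≡⟨ [≤]-*ʳ p a X _ ⟩
  ([ p ≤ a ] X) ℤ.* (([ q ≤ b ] Y) ℤ.* [ r ≤ c ] Z)
    ≡⟨ cong₂ ℤ._*_ ([≤]-δ p p′ a) (cong₂ ℤ._*_ ([≤]-δ q q′ b) ([≤]-δ r r′ c)) ⟩
  δ (p ℕ.+ p′) a ℤ.* (δ (q ℕ.+ q′) b ℤ.* δ (r ℕ.+ r′) c)
    ≡⟨ mono-δ (p ℕ.+ p′) (q ℕ.+ q′) (r ℕ.+ r′) a b c ⟨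
  mono (p ℕ.+ p′) (q ℕ.+ q′) (r ℕ.+ r′) a b c ∎
  where
  open ≡-Reasoning
  X Y Z : ℤ
  X = δ p′ (a ∸ p)
  Y = δ q′ (b ∸ q)
  Z = δ r′ (c ∸ r)

expand-[x₁-x₂][x₂-x₃] : (x₁ ⊖ x₂) ⊛ (x₂ ⊖ x₃) ≗₃ (mono 1 1 0 ⊖ mono 1 0 1) ⊖ (mono 0 2 0 ⊖ mono 0 1 1)
expand-[x₁-x₂][x₂-x₃] a b c = begin
  ((x₁ ⊖ x₂) ⊛ (x₂ ⊖ x₃)) a b c
    ≡⟨ ⊛-distribʳ-⊖ x₁ x₂ (x₂ ⊖ x₃) a b c ⟩
  (x₁ ⊛ (x₂ ⊖ x₃)) a b c ℤ.- (x₂ ⊛ (x₂ ⊖ x₃)) a b c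
    ≡⟨ cong₂ ℤ._-_ (⊛-distribˡ-⊖ x₁ x₂ x₃ a b c) (⊛-distribˡ-⊖ x₂ x₂ x₃ a b c) ⟩
  ((x₁ ⊛ x₂) a b c ℤ.- (x₁ ⊛ x₃) a b c) ℤ.- ((x₂ ⊛ x₂) a b c ℤ.- (x₂ ⊛ x₃) a b c)
    ≡⟨ cong₂ ℤ._-_ (cong₂ ℤ._-_ (product 1 0 0 0 1 0) (product 1 0 0 0 0 1))
                   (cong₂ ℤ._-_ (product 0 1 0 0 1 0) (product 0 1 0 0 0 1)) ⟩
  ((mono 1 1 0 ⊖ mono 1 0 1) ⊖ (mono 0 2 0 ⊖ mono 0 1 1)) a b c ∎
  where
  open ≡-Reasoning
  product : ∀ p q r p′ q′ r′ →
            (mono p q r ⊛ mono p′ q′ r′) a b c ≡ mono (p ℕ.+ p′) (q ℕ.+ q′) (r ℕ.+ r′) a b c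
  product p q r p′ q′ r′ = mono-⊛-mono p q r p′ q′ r′ a b c

S : Poly3
S = x₁ ⊕ x₂ ⊕ x₃

S-⊛ : ∀ R a b c →
      (S ⊛ R) a b c ≡ [ 1 ≤ a ] R (a ∸ 1) b c ℤ.+ [ 1 ≤ b ] R a (b ∸ 1) c ℤ.+ [ 1 ≤ c ] R a b (c ∸ 1)
S-⊛ R a b c =
  trans (⊛-distribʳ-⊕ (x₁ ⊕ x₂) x₃ R a b c)
        (cong₂ ℤ._+_ (trans (⊛-distribʳ-⊕ x₁ x₂ R a b c)
                            (cong₂ ℤ._+_ (mono-⊛ 1 0 0 R a b c) (mono-⊛ 0 1 0 R a b c)))
                     (mono-⊛ 0 0 1 R a b c))

-- n (n ∸ 1) ⋯ (n ∸ (k ∸ 1)); it vanishes for k > n, since truncated subtraction reaches 0.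
fallingFactorial : ℕ → ℕ → ℕ
fallingFactorial n zero    = 1
fallingFactorial n (suc k) = n ℕ.* fallingFactorial (n ∸ 1) k

+fallingFactorial-1 : ∀ n → + fallingFactorial n 1 ≡ + n
+fallingFactorial-1 n = cong +_ (ℕP.*-identityʳ n)

+fallingFactorial-2 : ∀ n → + fallingFactorial (suc n) 2 ≡ + suc n ℤ.* + n
+fallingFactorial-2 n =
  trans (ℤP.pos-* (suc n) (fallingFactorial n 1)) (cong (+ suc n ℤ.*_) (+fallingFactorial-1 n))

[≤]-*-fallingFactorial : ∀ p a (f : ℕ → ℤ) (F : ℕ → ℕ) N →
  (∀ m → F (suc m) ≡ suc m ℕ.* F m) →
  (∀ m → a ≡ p ℕ.+ m → f m ℤ.* + F m ≡ N) →
  ([ p ≤ a ] f (a ∸ p)) ℤ.* + F a ≡ + fallingFactorial a p ℤ.* N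
[≤]-*-fallingFactorial zero    a       f F N F-suc f*F≡N = trans (f*F≡N a refl) (sym (ℤP.*-identityˡ N))
[≤]-*-fallingFactorial (suc p) zero    f F N F-suc f*F≡N = refl
[≤]-*-fallingFactorial (suc p) (suc a) f F N F-suc f*F≡N = begin
  x ℤ.* + F (suc a)                        ≡⟨ cong (λ m → x ℤ.* + m) (F-suc a) ⟩
  x ℤ.* + (suc a ℕ.* F a)                  ≡⟨ cong (x ℤ.*_) (ℤP.pos-* (suc a) (F a)) ⟩
  x ℤ.* (+ suc a ℤ.* + F a)                ≡⟨ swap x (+ suc a) (+ F a) ⟩
  + suc a ℤ.* (x ℤ.* + F a)                ≡⟨ cong (+ suc a ℤ.*_) IH ⟩
  + suc a ℤ.* (+ fallingFactorial a p ℤ.* N) ≡⟨ ℤP.*-assoc (+ suc a) (+ fallingFactorial a p) N ⟨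
  + suc a ℤ.* + fallingFactorial a p ℤ.* N ≡⟨ cong (ℤ._* N) (ℤP.pos-* (suc a) (fallingFactorial a p)) ⟨
  + fallingFactorial (suc a) (suc p) ℤ.* N ∎
  where
  open ≡-Reasoning
  x : ℤ
  x = [ p ≤ a ] f (a ∸ p)
  IH : x ℤ.* + F a ≡ + fallingFactorial a p ℤ.* N
  IH = [≤]-*-fallingFactorial p a f F N F-suc (λ m a≡p+m → f*F≡N m (cong suc a≡p+m))
  swap : ∀ x y z → x ℤ.* (y ℤ.* z) ≡ y ℤ.* (x ℤ.* z)
  swap = solve-∀

exponents-cancel : ∀ p q r i j k {a b c n} →
                   a ≡ p ℕ.+ i → b ≡ q ℕ.+ j → c ≡ r ℕ.+ k →
                   a ℕ.+ b ℕ.+ c ≡ p ℕ.+ q ℕ.+ r ℕ.+ n → i ℕ.+ j ℕ.+ k ≡ n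
exponents-cancel p q r i j k refl refl refl sum =
  ℕP.+-cancelˡ-≡ (p ℕ.+ q ℕ.+ r) _ _ (trans (regroup p q r i j k) sum)
  where
  regroup : ∀ p q r i j k → p ℕ.+ q ℕ.+ r ℕ.+ (i ℕ.+ j ℕ.+ k) ≡ p ℕ.+ i ℕ.+ (q ℕ.+ j) ℕ.+ (r ℕ.+ k)
  regroup = ℕSolver.solve-∀

fact3-sucˡ : ∀ a b c → fact3 (suc a) b c ≡ suc a ℕ.* fact3 a b c
fact3-sucˡ a b c = pull (suc a) (a !) (b !) (c !)
  where
  pull : ∀ k x y z → k ℕ.* x ℕ.* y ℕ.* z ≡ k ℕ.* (x ℕ.* y ℕ.* z)
  pull = ℕSolver.solve-∀

fact3-sucᵐ : ∀ a b c → fact3 a (suc b) c ≡ suc b ℕ.* fact3 a b c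
fact3-sucᵐ a b c = pull (suc b) (a !) (b !) (c !)
  where
  pull : ∀ k x y z → x ℕ.* (k ℕ.* y) ℕ.* z ≡ k ℕ.* (x ℕ.* y ℕ.* z)
  pull = ℕSolver.solve-∀

fact3-sucʳ : ∀ a b c → fact3 a b (suc c) ≡ suc c ℕ.* fact3 a b c
fact3-sucʳ a b c = pull (suc c) (a !) (b !) (c !)
  where
  pull : ∀ k x y z → x ℕ.* y ℕ.* (k ℕ.* z) ≡ k ℕ.* (x ℕ.* y ℕ.* z)
  pull = ℕSolver.solve-∀

multinomial : ∀ n a b c → a ℕ.+ b ℕ.+ c ≡ n → (S ^ₚ n) a b c ℤ.* + fact3 a b c ≡ + (n !)
multinomial zero    zero    zero    zero    refl = refl
multinomial zero    zero    zero    (suc c) ()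
multinomial zero    zero    (suc b) c       ()
multinomial zero    (suc a) b       c       ()
multinomial (suc n) a b c sum = begin
  (S ^ₚ suc n) a b c ℤ.* + F
    ≡⟨ cong (ℤ._* + F) (S-⊛ Q a b c) ⟩
  (Tᵃ ℤ.+ Tᵇ ℤ.+ Tᶜ) ℤ.* + F
    ≡⟨ distrib Tᵃ Tᵇ Tᶜ (+ F) ⟩
  Tᵃ ℤ.* + F ℤ.+ Tᵇ ℤ.* + F ℤ.+ Tᶜ ℤ.* + F
    ≡⟨ cong₂ ℤ._+_ (cong₂ ℤ._+_ alongᵃ alongᵇ) alongᶜ ⟩
  + fallingFactorial a 1 ℤ.* N ℤ.+ + fallingFactorial b 1 ℤ.* N ℤ.+ + fallingFactorial c 1 ℤ.* N
    ≡⟨ distrib (+ fallingFactorial a 1) (+ fallingFactorial b 1) (+ fallingFactorial c 1) N ⟨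
  + (a ℕ.* 1 ℕ.+ b ℕ.* 1 ℕ.+ c ℕ.* 1) ℤ.* N
    ≡⟨ cong (λ s → + s ℤ.* N) (trans (unit a b c) sum) ⟩
  + suc n ℤ.* N
    ≡⟨ ℤP.pos-* (suc n) (n !) ⟨
  + (suc n !) ∎
  where
  open ≡-Reasoning
  Q : Poly3
  Q = S ^ₚ n
  N : ℤ
  N = + (n !)
  F : ℕ
  F = fact3 a b c
  Tᵃ Tᵇ Tᶜ : ℤ
  Tᵃ = [ 1 ≤ a ] Q (a ∸ 1) b c
  Tᵇ = [ 1 ≤ b ] Q a (b ∸ 1) c
  Tᶜ = [ 1 ≤ c ] Q a b (c ∸ 1)
  distrib : ∀ x y z w → (x ℤ.+ y ℤ.+ z) ℤ.* w ≡ x ℤ.* w ℤ.+ y ℤ.* w ℤ.+ z ℤ.* w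
  distrib = solve-∀
  unit : ∀ a b c → a ℕ.* 1 ℕ.+ b ℕ.* 1 ℕ.+ c ℕ.* 1 ≡ a ℕ.+ b ℕ.+ c
  unit = ℕSolver.solve-∀
  alongᵃ : Tᵃ ℤ.* + F ≡ + fallingFactorial a 1 ℤ.* N
  alongᵃ = [≤]-*-fallingFactorial 1 a (λ m → Q m b c) (λ m → fact3 m b c) N
             (λ m → fact3-sucˡ m b c)
             (λ m a≡1+m → multinomial n m b c (exponents-cancel 1 0 0 m b c a≡1+m refl refl sum))
  alongᵇ : Tᵇ ℤ.* + F ≡ + fallingFactorial b 1 ℤ.* N
  alongᵇ = [≤]-*-fallingFactorial 1 b (λ m → Q a m c) (λ m → fact3 a m c) N
             (λ m → fact3-sucᵐ a m c)
             (λ m b≡1+m → multinomial n a m c (exponents-cancel 0 1 0 a m c refl b≡1+m refl sum))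
  alongᶜ : Tᶜ ℤ.* + F ≡ + fallingFactorial c 1 ℤ.* N
  alongᶜ = [≤]-*-fallingFactorial 1 c (λ m → Q a b m) (λ m → fact3 a b m) N
             (λ m → fact3-sucʳ a b m)
             (λ m c≡1+m → multinomial n a b m (exponents-cancel 0 0 1 a b m refl refl c≡1+m sum))

mono-⊛-S^ : ∀ n p q r a b c → a ℕ.+ b ℕ.+ c ≡ p ℕ.+ q ℕ.+ r ℕ.+ n →
  (mono p q r ⊛ S ^ₚ n) a b c ℤ.* + fact3 a b c
    ≡ + fallingFactorial a p ℤ.* (+ fallingFactorial b q ℤ.* (+ fallingFactorial c r ℤ.* + (n !)))
mono-⊛-S^ n p q r a b c sum =
  trans (cong (ℤ._* + fact3 a b c) (mono-⊛ p q r Q a b c))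
    ([≤]-*-fallingFactorial p a (λ i → [ q ≤ b ] [ r ≤ c ] Q i (b ∸ q) (c ∸ r))
                            (λ i → fact3 i b c) _ (λ i → fact3-sucˡ i b c) λ i a≡p+i →
     [≤]-*-fallingFactorial q b (λ j → [ r ≤ c ] Q i j (c ∸ r))
                            (λ j → fact3 i j c) _ (λ j → fact3-sucᵐ i j c) λ j b≡q+j →
     [≤]-*-fallingFactorial r c (λ k → Q i j k)
                            (λ k → fact3 i j k) _ (λ k → fact3-sucʳ i j k) λ k c≡r+k →
     multinomial n i j k (exponents-cancel p q r i j k a≡p+i b≡q+j c≡r+k sum))
  where
  Q : Poly3
  Q = S ^ₚ n

⊛-expand : ∀ R → (x₁ ⊖ x₂) ⊛ (x₂ ⊖ x₃) ⊛ R ≗₃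
                 (mono 1 1 0 ⊛ R ⊖ mono 1 0 1 ⊛ R) ⊖ (mono 0 2 0 ⊛ R ⊖ mono 0 1 1 ⊛ R)
⊛-expand R a b c =
  trans (⊛-congˡ R expand-[x₁-x₂][x₂-x₃] a b c)
        (trans (⊛-distribʳ-⊖ (mono 1 1 0 ⊖ mono 1 0 1) (mono 0 2 0 ⊖ mono 0 1 1) R a b c)
               (cong₂ ℤ._-_ (⊛-distribʳ-⊖ (mono 1 1 0) (mono 1 0 1) R a b c)
                            (⊛-distribʳ-⊖ (mono 0 2 0) (mono 0 1 1) R a b c)))

coeff-*-fact3 : (k₁ k₂ k₃ : ℕ) → 1 ≤ k₁ → 1 ≤ k₂ → 1 ≤ k₃ →
  coeff ((x₁ ⊖ x₂) ⊛ (x₂ ⊖ x₃) ⊛ ((x₁ ⊕ x₂ ⊕ x₃) ^ₚ (k₁ ℕ.+ k₂ ℕ.+ k₃ ∸ 2))) k₁ k₂ k₃ ℤ.* + fact3 k₁ k₂ k₃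
    ≡ + ((k₁ ℕ.+ k₂ ℕ.+ k₃ ∸ 2) !) ℤ.* (+ k₂ ℤ.+ (+ k₂ ℤ.- + k₁) ℤ.* (+ k₃ ℤ.- + k₂))
coeff-*-fact3 (suc a) (suc b) (suc c) _ _ _ = begin
  ((x₁ ⊖ x₂) ⊛ (x₂ ⊖ x₃) ⊛ Q) k₁ k₂ k₃ ℤ.* + F
    ≡⟨ cong (ℤ._* + F) (⊛-expand Q k₁ k₂ k₃) ⟩
  ((T 1 1 0 ℤ.- T 1 0 1) ℤ.- (T 0 2 0 ℤ.- T 0 1 1)) ℤ.* + F
    ≡⟨ distrib (T 1 1 0) (T 1 0 1) (T 0 2 0) (T 0 1 1) (+ F) ⟩
  (T 1 1 0 ℤ.* + F ℤ.- T 1 0 1 ℤ.* + F) ℤ.- (T 0 2 0 ℤ.* + F ℤ.- T 0 1 1 ℤ.* + F)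
    ≡⟨ cong₂ ℤ._-_ (cong₂ ℤ._-_ (term 1 1 0 refl (+fallingFactorial-1 k₁) (+fallingFactorial-1 k₂) refl)
                                (term 1 0 1 refl (+fallingFactorial-1 k₁) refl (+fallingFactorial-1 k₃)))
                   (cong₂ ℤ._-_ (term 0 2 0 refl refl (+fallingFactorial-2 b) refl)
                                (term 0 1 1 refl refl (+fallingFactorial-1 k₂) (+fallingFactorial-1 k₃))) ⟩
  (+ k₁ ℤ.* (+ k₂ ℤ.* (1ℤ ℤ.* N)) ℤ.- + k₁ ℤ.* (1ℤ ℤ.* (+ k₃ ℤ.* N)))
    ℤ.- (1ℤ ℤ.* ((+ k₂ ℤ.* + b) ℤ.* (1ℤ ℤ.* N)) ℤ.- 1ℤ ℤ.* (+ k₂ ℤ.* (+ k₃ ℤ.* N)))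
    ≡⟨ identity (+ a) (+ b) (+ c) N ⟩
  N ℤ.* (+ k₂ ℤ.+ (+ k₂ ℤ.- + k₁) ℤ.* (+ k₃ ℤ.- + k₂)) ∎
  where
  open ≡-Reasoning
  k₁ k₂ k₃ n F : ℕ
  k₁ = suc a
  k₂ = suc b
  k₃ = suc c
  n = k₁ ℕ.+ k₂ ℕ.+ k₃ ∸ 2
  F = fact3 k₁ k₂ k₃
  Q : Poly3
  Q = S ^ₚ n
  N : ℤ
  N = + (n !)
  T : ℕ → ℕ → ℕ → ℤ
  T p q r = (mono p q r ⊛ Q) k₁ k₂ k₃
  sum : k₁ ℕ.+ k₂ ℕ.+ k₃ ≡ 2 ℕ.+ n
  sum = sym (ℕP.m+[n∸m]≡n (s≤s (ℕP.≤-trans (s≤s z≤n) (ℕP.m≤n+m k₃ (a ℕ.+ k₂)))))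
  term : ∀ p q r → p ℕ.+ q ℕ.+ r ≡ 2 → ∀ {u v w} →
         + fallingFactorial k₁ p ≡ u → + fallingFactorial k₂ q ≡ v → + fallingFactorial k₃ r ≡ w →
         T p q r ℤ.* + F ≡ u ℤ.* (v ℤ.* (w ℤ.* N))
  term p q r pqr≡2 refl refl refl = mono-⊛-S^ n p q r k₁ k₂ k₃ (trans sum (cong (ℕ._+ n) (sym pqr≡2)))
  distrib : ∀ x y z w f →
            ((x ℤ.- y) ℤ.- (z ℤ.- w)) ℤ.* f ≡ (x ℤ.* f ℤ.- y ℤ.* f) ℤ.- (z ℤ.* f ℤ.- w ℤ.* f)
  distrib = solve-∀
  identity : ∀ a b c N →
    ((1ℤ ℤ.+ a) ℤ.* ((1ℤ ℤ.+ b) ℤ.* (1ℤ ℤ.* N)) ℤ.- (1ℤ ℤ.+ a) ℤ.* (1ℤ ℤ.* ((1ℤ ℤ.+ c) ℤ.* N)))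
      ℤ.- (1ℤ ℤ.* (((1ℤ ℤ.+ b) ℤ.* b) ℤ.* (1ℤ ℤ.* N)) ℤ.- 1ℤ ℤ.* ((1ℤ ℤ.+ b) ℤ.* ((1ℤ ℤ.+ c) ℤ.* N)))
    ≡ N ℤ.* ((1ℤ ℤ.+ b) ℤ.+ ((1ℤ ℤ.+ b) ℤ.- (1ℤ ℤ.+ a)) ℤ.* ((1ℤ ℤ.+ c) ℤ.- (1ℤ ℤ.+ b)))
  identity = solve-∀

toℚ-cross-multiply : ∀ x y N F .{{_ : NonZero F}} →
                     x ℤ.* + F ≡ + N ℤ.* y → toℚ x ≡ (+ N ℚ./ F) ℚ.* toℚ y
toℚ-cross-multiply x y N (suc f) xF≡Ny = ℚP.toℚᵘ-injective (begin
  ℚ.toℚᵘ (toℚ x)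
    ≈⟨ ℚP.toℚᵘ-fromℚᵘ (mkℚᵘ x 0) ⟩
  mkℚᵘ x 0
    ≈⟨ *≡* cross ⟩
  mkℚᵘ (+ N) f ℚᵘ.* mkℚᵘ y 0
    ≈⟨ ℚᵘP.*-cong (ℚP.toℚᵘ-fromℚᵘ (mkℚᵘ (+ N) f)) (ℚP.toℚᵘ-fromℚᵘ (mkℚᵘ y 0)) ⟨
  ℚ.toℚᵘ (+ N ℚ./ suc f) ℚᵘ.* ℚ.toℚᵘ (toℚ y)
    ≈⟨ ℚP.toℚᵘ-homo-* (+ N ℚ./ suc f) (toℚ y) ⟨
  ℚ.toℚᵘ ((+ N ℚ./ suc f) ℚ.* toℚ y) ∎)
  where
  open ℚᵘP.≃-Reasoning
  cross : x ℤ.* + suc (f ℕ.* 1) ≡ + N ℤ.* y ℤ.* 1ℤ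
  cross = trans (cong (λ d → x ℤ.* + suc d) (ℕP.*-identityʳ f))
                (trans xF≡Ny (sym (ℤP.*-identityʳ (+ N ℤ.* y))))

fact3≢0 : ∀ k₁ k₂ k₃ → NonZero (fact3 k₁ k₂ k₃)
fact3≢0 k₁ k₂ k₃ = ℕP.m*n≢0 (k₁ ! ℕ.* k₂ !) (k₃ !) {{k₁ ℕP.!* k₂ !≢0}} {{k₃ ℕP.!≢0}}

lemma2p3 : (k₁ k₂ k₃ : ℕ) → 1 ≤ k₁ → 1 ≤ k₂ → 1 ≤ k₃ →
    toℚ (coeff ((x₁ ⊖ x₂) ⊛ (x₂ ⊖ x₃) ⊛ ((x₁ ⊕ x₂ ⊕ x₃) ^ₚ (k₁ ℕ.+ k₂ ℕ.+ k₃ ∸ 2))) k₁ k₂ k₃)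
      ≡ ((+ ((k₁ ℕ.+ k₂ ℕ.+ k₃ ∸ 2) ℕ.!)) /fact3 (k₁ , k₂ , k₃))
        ℚ.* toℚ (+ k₂ ℤ.+ (+ k₂ ℤ.- + k₁) ℤ.* (+ k₃ ℤ.- + k₂))
lemma2p3 k₁ k₂ k₃ 1≤k₁ 1≤k₂ 1≤k₃ =
  toℚ-cross-multiply coefficient (+ k₂ ℤ.+ (+ k₂ ℤ.- + k₁) ℤ.* (+ k₃ ℤ.- + k₂)) (n !)
                     (fact3 k₁ k₂ k₃) {{fact3≢0 k₁ k₂ k₃}}
                     (coeff-*-fact3 k₁ k₂ k₃ 1≤k₁ 1≤k₂ 1≤k₃)
  where
  n : ℕ
  n = k₁ ℕ.+ k₂ ℕ.+ k₃ ∸ 2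
  coefficient : ℤ
  coefficient = coeff ((x₁ ⊖ x₂) ⊛ (x₂ ⊖ x₃) ⊛ ((x₁ ⊕ x₂ ⊕ x₃) ^ₚ n)) k₁ k₂ k₃
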